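{- Let $T=(V,\mathcal{E})$ be a tree with a designated root $r$, and let $E$ be a set of links on $V$ that is closed under shadows. Let $F$ be a shadows-minimal cover of $T$ by links of $E$ that has minimum size, and that among all minimum-size shadows-minimal covers has the maximum number of twin links. Then no link of $F$ overlaps another link of $F$.
   Context: For nodes $u,v$ of the tree $T$, $P(uv)$ is the path in $T$ between $u$ and $v$; a link $uv$ covers the edges of $P(uv)$. A cover of $T$ is a set of links covering all tree edges. A link $u'v'$ is a shadow of a link $uv$ if $P(u'v')\subseteq P(uv)$; it is a proper shadow if it is a shadow and $u'v'\neq uv$. The set $E$ is closed under shadows if every shadow of a link of $E$ is in $E$. An inclusion-minimal cover $F$ is shadows-minimal if, for every $uv\in F$, replacing $uv$ by any proper shadow of $uv$ yields a set that does not cover $T$. Leaves of $T$ are the nodes other than $r$ with no descendants. A link between leaves $a,b$ is a twin link if contracting the path $P(ab)$ into a single node yields a new leaf. A link $by$ overlaps a link $ax$ if $P(ax)$ and $P(by)$ share an edge and at least one of $a,x$ lies on $P(by)$. -}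

module Defs where

open import Data.Nat as ℕ using (ℕ; suc)
open import Data.Fin as Fin using (Fin; zero; suc; toℕ)
open import Data.Product using (Σ; ∃; ∃-syntax; _×_; _,_)
open import Data.Sum using (_⊎_)
open import Data.List using (List; length)
open import Data.List.Membership.Propositional using (_∈_)
open import Data.List.Relation.Binary.Subset.Propositional using (_⊆_)
open import Data.List.Relation.Unary.All using (All)
open import Data.List.Relation.Unary.Unique.Propositional using (Unique)
open import Relation.Nullary using (¬_)
open import Relation.Binary.PropositionalEquality using (_≡_; _≢_)

-- Node  suc i  (i : Fin n) has parent  parent i, whose index is
-- strictly smaller (every rooted tree admits such a labelling, e.g. BFS).
-- The tree edges are in bijection with the non-root nodes: the edge
-- e : Fin n  is the edge between node  suc e  and its parent  parent e.

record Tree (n : ℕ) : Set where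
  field
    parent    : Fin n → Fin (suc n)
    parent-lt : ∀ i → toℕ (parent i) ℕ.≤ toℕ i
open Tree public

Node : ℕ → Set
Node n = Fin (suc n)

Edge : ℕ → Set
Edge n = Fin n

root : ∀ {n} → Node n
root = zero

-- A link: a pair of distinct nodes, stored with  u < v  so that the
-- unordered pair has a unique representation.
record Link (n : ℕ) : Set where
  constructor link
  field
    u v : Node n
    .lt : u Fin.< v
open Link public

module _ {n : ℕ} (T : Tree n) where

  data _≼_ : Node n → Node n → Set where
    here : ∀ {c} → c ≼ c
    step : ∀ {c i} → c ≼ parent T i → c ≼ suc i

  -- edge e lies on the tree path P(xy): exactly one of x,y is in the
  -- subtree below e.
  EdgeOnPath : Edge n → Node n → Node n → Set
  EdgeOnPath e x y = (suc e ≼ x × ¬ (suc e ≼ y)) ⊎ (¬ (suc e ≼ x) × suc e ≼ y)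

  NodeOnPath : Node n → Node n → Node n → Set
  NodeOnPath w x y =
    w ≡ x ⊎ w ≡ y ⊎ (∃[ e ] EdgeOnPath e x y × (w ≡ suc e ⊎ w ≡ parent T e))

  CoversEdge : Link n → Edge n → Set
  CoversEdge l e = EdgeOnPath e (u l) (v l)

  CoversP : (Link n → Set) → Set
  CoversP S = ∀ e → ∃[ l ] (S l × CoversEdge l e)

  Covers : List (Link n) → Set
  Covers F = CoversP (_∈ F)

  -- l' is a shadow of l :  P(l') ⊆ P(l)  (as edge sets; links join distinct
  -- nodes, so their paths are nonempty and edge inclusion = path inclusion)
  Shadow : Link n → Link n → Set
  Shadow l' l = ∀ e → CoversEdge l' e → CoversEdge l e

  ProperShadow : Link n → Link n → Set
  ProperShadow l' l = Shadow l' l × l' ≢ l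

  ClosedUnderShadows : (Link n → Set) → Set
  ClosedUnderShadows E = ∀ l l' → E l → Shadow l' l → E l'

  InclusionMinimalCover : List (Link n) → Set
  InclusionMinimalCover F =
    Covers F × (∀ G → G ⊆ F → Covers G → F ⊆ G)

  ShadowsMinimalCover : List (Link n) → Set
  ShadowsMinimalCover F =
    InclusionMinimalCover F ×
    (∀ l → l ∈ F → ∀ l' → ProperShadow l' l →
       ¬ CoversP (λ x → x ≡ l' ⊎ (x ∈ F × x ≢ l)))

  SMCoverBy : (Link n → Set) → List (Link n) → Set
  SMCoverBy E F = Unique F × All E F × ShadowsMinimalCover F

  Leaf : Node n → Set
  Leaf x = x ≢ root × (∀ y → x ≼ y → y ≡ x)

  -- twin link: link between leaves a, b such that contracting P(ab) into a
  -- single node yields a leaf: the contracted node is not the root (r ∉ P(ab))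
  -- and has no children (every node whose parent is on P(ab) is on P(ab)).
  Twin : Link n → Set
  Twin l =
    Leaf (u l) × Leaf (v l) ×
    ¬ NodeOnPath root (u l) (v l) ×
    (∀ i → NodeOnPath (parent T i) (u l) (v l) → NodeOnPath (suc i) (u l) (v l))

  TwinsOf : List (Link n) → List (Link n) → Set
  TwinsOf F Ts = Unique Ts × Ts ⊆ F × All Twin Ts × (∀ l → l ∈ F → Twin l → l ∈ Ts)

  Overlaps : Link n → Link n → Set
  Overlaps l' l =
    (∃[ e ] CoversEdge l e × CoversEdge l' e) ×
    (NodeOnPath (u l) (u l') (v l') ⊎ NodeOnPath (v l) (u l') (v l'))

module Submission where

-- Let ax ∈ F be overlapped by l' ∈ F, say with the endpoint a of ax on
-- P(l') (the case of x is symmetric).  Let e₁ be the edge of P(ax) incident to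
-- a, with other endpoint a₁.  Since a ∈ P(l') and the two paths share an edge,
-- e₁ is already covered by l'.  But P(a₁x) = P(ax) ∖ {e₁}, so:
--   * if a₁ = x, F without ax still covers T, against inclusion-minimality;
--   * otherwise a₁x is a proper shadow of ax, and replacing ax by a₁x keeps a
--     cover, against shadows-minimality.
-- Hence the claim holds for every shadows-minimal cover.

open import Defs hiding (_≼_)
import Defs
open import Data.Nat using (ℕ; _≤_; s≤s)
import Data.Nat as ℕ
open import Data.Nat.Properties using (≤-trans; ≤-refl; n≤1+n; 1+n≰n)
open import Data.Fin using (zero; suc; toℕ)
open import Data.Fin.Properties using (_≟_; <-cmp; suc-injective)
open import Data.Product using (Σ; ∃-syntax; _×_; _,_; proj₁; proj₂)
open import Data.Sum using (_⊎_; inj₁; inj₂)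
open import Data.Empty using (⊥; ⊥-elim)
open import Data.List using (List; length; filter)
open import Data.List.Membership.Propositional using (_∈_)
open import Data.List.Membership.Propositional.Properties using (∈-filter⁺; ∈-filter⁻)
open import Relation.Nullary using (¬_; Dec; yes; no; ¬?)
open import Relation.Binary.Definitions using (tri<; tri≈; tri>)
open import Relation.Binary.PropositionalEquality using (_≡_; _≢_; refl; sym; cong; subst)

module _ {n : ℕ} (T : Tree n) where

  private
    _≼_ : Node n → Node n → Set
    _≼_ = Defs._≼_ T

    OnPath : Edge n → Node n → Node n → Set
    OnPath = EdgeOnPath T

  ≼-trans : ∀ {a b c} → a ≼ b → b ≼ c → a ≼ c
  ≼-trans p here = p
  ≼-trans p (step q) = step (≼-trans p q)

  ≼-toℕ : ∀ {a b} → a ≼ b → toℕ a ≤ toℕ b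
  ≼-toℕ here = ≤-refl
  ≼-toℕ (step {i = i} q) = ≤-trans (≼-toℕ q) (≤-trans (parent-lt T i) (n≤1+n _))

  child⋠parent : ∀ {i} → ¬ (suc i ≼ parent T i)
  child⋠parent {i} p = 1+n≰n (≤-trans (≼-toℕ p) (parent-lt T i))

  ≼-suc-inv : ∀ {c i} → c ≼ suc i → c ≡ suc i ⊎ c ≼ parent T i
  ≼-suc-inv here = inj₁ refl
  ≼-suc-inv (step q) = inj₂ q

  ≼-comparable : ∀ {c d x} → c ≼ x → d ≼ x → c ≼ d ⊎ d ≼ c
  ≼-comparable here q = inj₂ q
  ≼-comparable (step p) here = inj₁ (step p)
  ≼-comparable (step p) (step q) = ≼-comparable p q

  downward-induction : (P : Node n → Set) → P root →
    (∀ i → P (parent T i) → P (suc i)) → ∀ x → P x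
  downward-induction P base next x = go (toℕ x) x ≤-refl
    where
    go : ∀ k x → toℕ x ≤ k → P x
    go _ zero _ = base
    go (ℕ.suc k) (suc i) (s≤s b) = next i (go k (parent T i) (≤-trans (parent-lt T i) b))

  root≼ : ∀ x → root ≼ x
  root≼ = downward-induction (root ≼_) here (λ _ → step)

  _≼?_ : ∀ c x → Dec (c ≼ x)
  c ≼? x = downward-induction (λ x → Dec (c ≼ x)) atRoot next x
    where
    atRoot : Dec (c ≼ root)
    atRoot with c ≟ root
    ... | yes refl = yes here
    ... | no c≢r = no λ { here → c≢r refl }
    next : ∀ i → Dec (c ≼ parent T i) → Dec (c ≼ suc i)
    next i d with c ≟ suc i | d
    ... | yes refl | _ = yes here
    ... | no _ | yes p = yes (step p)
    ... | no c≢i | no ¬p = no λ { here → c≢i refl ; (step p) → ¬p p }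

  descend : ∀ {a x} → a ≼ x → a ≡ x ⊎ ∃[ e ] (parent T e ≡ a × suc e ≼ x)
  descend here = inj₁ refl
  descend (step {i = i} p) with descend p
  ... | inj₁ eq = inj₂ (i , sym eq , here)
  ... | inj₂ (e , eq , q) = inj₂ (e , eq , step q)

  siblings-≡ : ∀ {e e' z} → parent T e ≡ parent T e' → suc e ≼ z → suc e' ≼ z → suc e ≡ suc e'
  siblings-≡ {e} {e'} eq p q with ≼-comparable p q
  ... | inj₁ r with ≼-suc-inv r
  ...   | inj₁ same = same
  ...   | inj₂ r' = ⊥-elim (child⋠parent (subst (suc e ≼_) (sym eq) r'))
  siblings-≡ {e} {e'} eq p q | inj₂ r with ≼-suc-inv r
  ...   | inj₁ same = sym same
  ...   | inj₂ r' = ⊥-elim (child⋠parent (subst (suc e' ≼_) eq r'))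

  onPath-sym : ∀ {e a b} → OnPath e a b → OnPath e b a
  onPath-sym (inj₁ (p , q)) = inj₂ (q , p)
  onPath-sym (inj₂ (p , q)) = inj₁ (q , p)

  onPath-trivial : ∀ {e a} → ¬ OnPath e a a
  onPath-trivial (inj₁ (p , q)) = q p
  onPath-trivial (inj₂ (p , q)) = p q

  nodeOnPath-above : ∀ {w b y} → NodeOnPath T w b y → w ≼ b ⊎ w ≼ y
  nodeOnPath-above (inj₁ refl) = inj₁ here
  nodeOnPath-above (inj₂ (inj₁ refl)) = inj₂ here
  nodeOnPath-above (inj₂ (inj₂ (e , inj₁ (p , _) , inj₁ refl))) = inj₁ p
  nodeOnPath-above (inj₂ (inj₂ (e , inj₂ (_ , p) , inj₁ refl))) = inj₂ p
  nodeOnPath-above (inj₂ (inj₂ (e , inj₁ (p , _) , inj₂ refl))) = inj₁ (≼-trans (step here) p)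
  nodeOnPath-above (inj₂ (inj₂ (e , inj₂ (_ , p) , inj₂ refl))) = inj₂ (≼-trans (step here) p)

  parentOffPath : ∀ {e b y} → suc e ≼ b → suc e ≼ y → ¬ NodeOnPath T (parent T e) b y
  parentOffPath {e} cb cy (inj₁ eq) = child⋠parent (subst (suc e ≼_) (sym eq) cb)
  parentOffPath {e} cb cy (inj₂ (inj₁ eq)) = child⋠parent (subst (suc e ≼_) (sym eq) cy)
  parentOffPath {e} cb cy (inj₂ (inj₂ (e' , onP , inj₁ eq)))
    with step {i = e} (subst (suc e' ≼_) (sym eq) here)
  ... | e'≼e with onP
  ...   | inj₁ (_ , ¬e'≼y) = ¬e'≼y (≼-trans e'≼e cy)
  ...   | inj₂ (¬e'≼b , _) = ¬e'≼b (≼-trans e'≼e cb)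
  parentOffPath {y = y} cb cy (inj₂ (inj₂ (e' , inj₁ (e'≼b , ¬e'≼y) , inj₂ eq))) =
    ¬e'≼y (subst (_≼ y) (sym (siblings-≡ (sym eq) e'≼b cb)) cy)
  parentOffPath {b = b} cb cy (inj₂ (inj₂ (e' , inj₂ (¬e'≼b , e'≼y) , inj₂ eq))) =
    ¬e'≼b (subst (_≼ b) (sym (siblings-≡ (sym eq) e'≼y cy)) cb)

  leavingPathDisjoint : ∀ {e a x b y} → a ≼ b → a ≼ y → ¬ a ≼ x → OnPath e a x → ¬ OnPath e b y
  leavingPathDisjoint ab ay ¬ax (inj₁ (ea , _)) (inj₁ (_ , ¬ey)) = ¬ey (≼-trans ea ay)
  leavingPathDisjoint ab ay ¬ax (inj₁ (ea , _)) (inj₂ (¬eb , _)) = ¬eb (≼-trans ea ab)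
  leavingPathDisjoint ab ay ¬ax (inj₂ (¬ea , ex)) (inj₁ (eb , _)) with ≼-comparable eb ab
  ... | inj₁ ea = ¬ea ea
  ... | inj₂ ae = ¬ax (≼-trans ae ex)
  leavingPathDisjoint ab ay ¬ax (inj₂ (¬ea , ex)) (inj₂ (_ , ey)) with ≼-comparable ey ay
  ... | inj₁ ea = ¬ea ea
  ... | inj₂ ae = ¬ax (≼-trans ae ex)

  data Adj (e : Edge n) : Node n → Node n → Set where
    up   : Adj e (suc e) (parent T e)
    down : Adj e (parent T e) (suc e)

  adj-sym : ∀ {e a a₁} → Adj e a a₁ → Adj e a₁ a
  adj-sym up = down
  adj-sym down = up

  adj-preserves-below : ∀ {e e₁ a a₁} → Adj e₁ a a₁ → e ≢ e₁ → suc e ≼ a → suc e ≼ a₁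
  adj-preserves-below up e≢e₁ p with ≼-suc-inv p
  ... | inj₁ eq = ⊥-elim (e≢e₁ (suc-injective eq))
  ... | inj₂ q = q
  adj-preserves-below down _ = step

  onPath-move : ∀ {e e₁ a a₁ x} → Adj e₁ a a₁ → e ≢ e₁ → OnPath e a x → OnPath e a₁ x
  onPath-move ad ne (inj₁ (p , q)) = inj₁ (adj-preserves-below ad ne p , q)
  onPath-move ad ne (inj₂ (p , q)) = inj₂ ((λ r → p (adj-preserves-below (adj-sym ad) ne r)) , q)

  onPath-drop : ∀ {e₁ a a₁ x} → Adj e₁ a a₁ → OnPath e₁ a x → ¬ OnPath e₁ a₁ x
  onPath-drop up h h' = dropUp h h'
    where
    dropUp : ∀ {e₁ x} → OnPath e₁ (suc e₁) x → ¬ OnPath e₁ (parent T e₁) x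
    dropUp (inj₁ _) (inj₁ (p , _)) = child⋠parent p
    dropUp (inj₁ (_ , ¬x)) (inj₂ (_ , q)) = ¬x q
    dropUp (inj₂ (¬h , _)) _ = ¬h here
  onPath-drop down h h' = onPath-drop up h' h

  onPath-shorter : ∀ {e e₁ a a₁ x} → Adj e₁ a a₁ → OnPath e₁ a x → OnPath e a₁ x → OnPath e a x
  onPath-shorter {e} {e₁} ad h₁ h with e ≟ e₁
  ... | yes refl = ⊥-elim (onPath-drop ad h₁ h)
  ... | no ne = onPath-move (adj-sym ad) ne h

  FirstEdgeShared : Node n → Node n → Node n → Node n → Set
  FirstEdgeShared a x b y =
    ∃[ e₁ ] ∃[ a₁ ] (Adj e₁ a a₁ × OnPath e₁ a x × OnPath e₁ b y)

  firstEdgeShared : ∀ {e₀ a x b y} → OnPath e₀ a x → OnPath e₀ b y →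
    NodeOnPath T a b y → FirstEdgeShared a x b y
  firstEdgeShared {a = a} {x} h₀ h₀' a∈by with a ≼? x
  firstEdgeShared {x = x} {b} {y} h₀ h₀' a∈by | yes ax with descend ax
  ... | inj₁ refl = ⊥-elim (onPath-trivial h₀)
  ... | inj₂ (e₁ , refl , cx) =
        e₁ , suc e₁ , down , inj₂ (child⋠parent , cx) , sharedBelow (childAbove h₀) h₀'
    where
    childAbove : ∀ {e₀} → OnPath e₀ (parent T e₁) x → suc e₁ ≼ suc e₀
    childAbove (inj₁ (ea , ¬ex)) = ⊥-elim (¬ex (≼-trans ea ax))
    childAbove (inj₂ (¬ea , ex)) with ≼-comparable ex cx
    ... | inj₂ r = r
    ... | inj₁ r with ≼-suc-inv r
    ...   | inj₁ eq = subst (suc e₁ ≼_) (sym eq) here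
    ...   | inj₂ r' = ⊥-elim (¬ea r')
    sharedBelow : ∀ {e₀} → suc e₁ ≼ suc e₀ → OnPath e₀ b y → OnPath e₁ b y
    sharedBelow c (inj₁ (eb , _)) = inj₁ (≼-trans c eb , λ cy → parentOffPath (≼-trans c eb) cy a∈by)
    sharedBelow c (inj₂ (_ , ey)) = inj₂ ((λ cb → parentOffPath cb (≼-trans c ey) a∈by) , ≼-trans c ey)
  firstEdgeShared {a = zero} {x} h₀ h₀' a∈by | no ¬ax = ⊥-elim (¬ax (root≼ x))
  firstEdgeShared {a = suc e₁} {x} {b} {y} h₀ h₀' a∈by | no ¬ax =
    e₁ , parent T e₁ , up , inj₁ (here , ¬ax) , exactlyOneBelow (suc e₁ ≼? b) (suc e₁ ≼? y)
    where
    exactlyOneBelow : Dec (suc e₁ ≼ b) → Dec (suc e₁ ≼ y) → OnPath e₁ b y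
    exactlyOneBelow (yes ab) (yes ay) = ⊥-elim (leavingPathDisjoint ab ay ¬ax h₀ h₀')
    exactlyOneBelow (yes ab) (no ¬ay) = inj₁ (ab , ¬ay)
    exactlyOneBelow (no ¬ab) (yes ay) = inj₂ (¬ab , ay)
    exactlyOneBelow (no ¬ab) (no ¬ay) with nodeOnPath-above a∈by
    ... | inj₁ ab = ⊥-elim (¬ab ab)
    ... | inj₂ ay = ⊥-elim (¬ay ay)

  linkBetween : (p q : Node n) → p ≢ q →
    Σ (Link n) λ l → (∀ e → CoversEdge T l e → OnPath e p q) × (∀ e → OnPath e p q → CoversEdge T l e)
  linkBetween p q ne with <-cmp p q
  ... | tri< lt _ _ = link p q lt , (λ _ h → h) , (λ _ h → h)
  ... | tri≈ _ eq _ = ⊥-elim (ne eq)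
  ... | tri> _ _ gt = link q p gt , (λ _ h → onPath-sym h) , (λ _ h → onPath-sym h)

  _≟L_ : (l₁ l₂ : Link n) → Dec (l₁ ≡ l₂)
  link u₁ v₁ _ ≟L link u₂ v₂ _ with u₁ ≟ u₂ | v₁ ≟ v₂
  ... | yes refl | yes refl = yes refl
  ... | no ne | _ = no (λ eq → ne (cong Link.u eq))
  ... | yes _ | no ne = no (λ eq → ne (cong Link.v eq))

  coverWithout : ∀ {F l} (S : Link n → Set) → Covers T F →
    (∀ z → z ∈ F → z ≢ l → S z) →
    (∀ e → CoversEdge T l e → ∃[ z ] (S z × CoversEdge T z e)) → CoversP T S
  coverWithout {l = l} S cov keep patch e with cov e
  ... | z , z∈F , cz with z ≟L l
  ...   | no z≢l = z , keep z z∈F z≢l , cz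
  ...   | yes refl = patch e cz

  trimmableLink : (F : List (Link n)) → ShadowsMinimalCover T F →
    ∀ {l l' a x e₁ a₁} → l ∈ F → l' ∈ F → l' ≢ l →
    (∀ e → CoversEdge T l e → OnPath e a x) → (∀ e → OnPath e a x → CoversEdge T l e) →
    Adj e₁ a a₁ → OnPath e₁ a x → CoversEdge T l' e₁ → ⊥
  trimmableLink F ((cov , inclMin) , shadowMin) {l} {l'} {a} {x} {e₁} {a₁}
                l∈F l'∈F l'≢l to fro ad h₁ c₁ with a₁ ≟ x
  ... | yes refl = proj₂ (∈-filter⁻ notL {xs = F} l∈rest) refl
    where
    -- P(ax) = {e₁}, so l is redundant.
    notL = λ z → ¬? (z ≟L l)
    rest = filter notL F
    patch : ∀ e → CoversEdge T l e → ∃[ z ] (z ∈ rest × CoversEdge T z e)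
    patch e c with e ≟ e₁
    ... | yes refl = l' , ∈-filter⁺ notL l'∈F l'≢l , c₁
    ... | no ne = ⊥-elim (onPath-trivial (onPath-move ad ne (to e c)))
    l∈rest : l ∈ rest
    l∈rest = inclMin rest (λ m → proj₁ (∈-filter⁻ notL m))
               (coverWithout (_∈ rest) cov (λ z z∈F z≢l → ∈-filter⁺ notL z∈F z≢l) patch) l∈F
  ... | no a₁≢x with linkBetween a₁ x a₁≢x
  ...   | (l'' , to'' , fro'') = shadowMin l l∈F l'' (shadow , proper) replacedCovers
    where
    shadow : Shadow T l'' l
    shadow e c = fro e (onPath-shorter ad h₁ (to'' e c))
    proper : l'' ≢ l
    proper refl = onPath-drop ad h₁ (to'' e₁ (fro e₁ h₁))
    replacedCovers : CoversP T (λ z → z ≡ l'' ⊎ (z ∈ F × z ≢ l))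
    replacedCovers = coverWithout _ cov (λ z z∈F z≢l → inj₂ (z∈F , z≢l)) patch
      where
      patch : ∀ e → CoversEdge T l e → ∃[ z ] ((z ≡ l'' ⊎ (z ∈ F × z ≢ l)) × CoversEdge T z e)
      patch e c with e ≟ e₁
      ... | yes refl = l' , inj₂ (l'∈F , l'≢l) , c₁
      ... | no ne = l'' , inj₁ refl , fro'' e (onPath-move ad ne (to e c))

  noOverlapAtEnd : (F : List (Link n)) → ShadowsMinimalCover T F →
    ∀ {l l' a x e₀} → l ∈ F → l' ∈ F → l' ≢ l →
    (∀ e → CoversEdge T l e → OnPath e a x) → (∀ e → OnPath e a x → CoversEdge T l e) →
    OnPath e₀ a x → CoversEdge T l' e₀ → ¬ NodeOnPath T a (u l') (v l')
  noOverlapAtEnd F smc l∈F l'∈F l'≢l to fro h₀ h₀' a∈l'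
    with firstEdgeShared h₀ h₀' a∈l'
  ... | e₁ , a₁ , ad , h₁ , c₁ = trimmableLink F smc l∈F l'∈F l'≢l to fro ad h₁ c₁

claim2p5 : (n : ℕ) (T : Tree n) (E : Link n → Set) → ClosedUnderShadows T E →
    (F : List (Link n)) → SMCoverBy T E F →
    (∀ G → SMCoverBy T E G → length F ≤ length G) →
    (∀ G → SMCoverBy T E G → length G ≡ length F →
    ∀ TG TF → TwinsOf T G TG → TwinsOf T F TF → length TG ≤ length TF) →
    ∀ l l' → l ∈ F → l' ∈ F → l' ≢ l → ¬ Overlaps T l' l
claim2p5 n T E _ F (_ , _ , smc) _ _ l l' l∈F l'∈F l'≢l ((e₀ , c , c') , inj₁ u∈l') =
  noOverlapAtEnd T F smc l∈F l'∈F l'≢l (λ _ h → h) (λ _ h → h) c c' u∈l'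
claim2p5 n T E _ F (_ , _ , smc) _ _ l l' l∈F l'∈F l'≢l ((e₀ , c , c') , inj₂ v∈l') =
  noOverlapAtEnd T F smc l∈F l'∈F l'≢l (λ _ h → onPath-sym T h) (λ _ h → onPath-sym T h)
    (onPath-sym T c) c' v∈l'
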